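{- Let $n \ge 2$. The mutual search algorithm HalfInTurn$_n$ has cost exactly $n-1$.
   Context: Setting: two agents occupy two distinct sites among $n$ sites $V=\{0,1,\ldots,n-1\}$; an agent at site $i$ may query a site $j$, and the search ends at the first query that finds the other agent. A deterministic synchronous mutual search (MS) algorithm for two agents is an ordered tournament $T=(V,E,\prec)$: $E$ contains, for each unordered pair $\{i,j\}$ of distinct sites, exactly one of the arcs $(i,j)$, $(j,i)$ (arc $(i,j)$: an agent at $i$ queries $j$), and $\prec$ is a total order on $E$. Row $E_i$ is the set of arcs leaving $i$. The cost of an arc $e=(i,j)$ is $c(e)=|\{f\in E_i: f\prec e\}|+1+|\{f\in E_j: f\prec e\}|$, and the cost $c(T)$ is the maximum of $c(e)$ over $e\in E$. HalfInTurn$_n$: site $i$ queries the sites $(i+1)\bmod n,(i+2)\bmod n,\ldots,(i+\lfloor n/2\rfloor)\bmod n$ in this order, except that when $n$ is even the sites $i\ge n/2$ omit their last query (to $(i+n/2)\bmod n$), so that each pair is queried exactly once. The sites take turns in the order $0,1,\ldots,n-1$: all queries of site $0$ precede all queries of site $1$, which precede all queries of site $2$, etc. -}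

module Defs where

open import Data.Nat using (ℕ; zero; suc; _+_; _∸_; _⊔_; _≡ᵇ_; _≤ᵇ_; _/_; _%_)
open import Data.Bool using (Bool; true; false; if_then_else_; _∧_)
open import Data.List using (List; []; _∷_; _++_; [_]; map; concatMap; upTo; filter; length; foldr)
open import Data.Product using (_×_; _,_; proj₁)
open import Relation.Binary.PropositionalEquality using (_≡_)
open import Data.Nat.Properties using (_≟_)

-- Sites are natural numbers 0..n-1.  An arc (i , j) means: an agent at i queries j.
Arc : Set
Arc = ℕ × ℕ

-- An ordered tournament is given by the list of its arcs; the total order ≺
-- on E is the order of appearance in the list (earlier = smaller).
OrderedTournament : Set
OrderedTournament = List Arc

rowCount : ℕ → List Arc → ℕ
rowCount i prev = length (filter (λ f → proj₁ f ≟ i) prev)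

-- c(e) for e = (i , j), where `prev` is the list of arcs f with f ≺ e
arcCost : List Arc → Arc → ℕ
arcCost prev (i , j) = rowCount i prev + 1 + rowCount j prev

arcCosts : List Arc → List Arc → List ℕ
arcCosts prev []       = []
arcCosts prev (e ∷ es) = arcCost prev e ∷ arcCosts (prev ++ [ e ]) es

cost : OrderedTournament → ℕ
cost T = foldr _⊔_ 0 (arcCosts [] T)

numQueries : ℕ → ℕ → ℕ
numQueries n i =
  if ((n % 2) ≡ᵇ 0) ∧ ((n / 2) ≤ᵇ i) then (n / 2) ∸ 1 else n / 2

row : ℕ → ℕ → List Arc
row zero    i = []
row (suc m) i = map (λ k → (i , (i + suc k) % suc m)) (upTo (numQueries (suc m) i))

-- (for n = 0 there are no sites, so the row is irrelevant and set to [])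

halfInTurn : ℕ → OrderedTournament
halfInTurn n = concatMap (row n) (upTo n)

-- Site i makes its k-th query (counting from 0) to t = i + 1 + k mod n after k queries of its
-- own.  If t > i, site t has not had its turn yet and the query costs k + 1 ≤ ⌊n/2⌋; if the query
-- wraps around (t < i), site t has already made all of its numQueries n t queries.  Since
-- k + 1 ≤ ⌊n/2⌋, wrapping forces i ≥ ⌊n/2⌋, and then k + 1 + numQueries n t ≤ n - 1 in both
-- parities (for even n the rows with i ≥ n/2 are one query shorter).  For n ≥ 3 the last query
-- of site n - 1 attains n - 1; for n = 2 site 1 makes no query at all.
module Submission where

open import Defs
open import Data.Nat using (ℕ; _≤_; _∸_)
open import Relation.Binary.PropositionalEquality using (_≡_)

open import Data.Nat using (zero; suc; _+_; _<_; _⊔_; _/_; _%_; NonZero; _≤ᵇ_; _≡ᵇ_; s≤s; s≤s⁻¹; z≤n; z<s; _<?_)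
open import Data.Nat.Properties
open import Data.Nat.DivMod using (m≡m%n+[m/n]*n; m%n<n; m<n⇒m%n≡m; [m+n]%n≡m%n; m/n<m)
open import Data.Bool using (true; false; _∧_; T)
open import Data.List using (List; []; _∷_; _++_; [_]; _∷ʳ_; map; concat; concatMap; upTo; filter; length; foldr)
open import Data.List.Properties
  using (map-++; length-++; upTo-∷ʳ; concatMap-++; ++-identityʳ; ++-assoc; filter-++;
         length-upTo; filter-accept; filter-reject; map-cong-local)
open import Data.List.Relation.Unary.All using (All; []; _∷_)
open import Data.List.Relation.Unary.All.Properties using (applyUpTo⁺₁; concat⁺; map⁺)
open import Data.List.Relation.Unary.Any using (here; there)
open import Data.List.Membership.Propositional using (_∈_; lose)
open import Data.List.Membership.Propositional.Properties using (∈-map⁺; ∈-concatMap⁺; ∈-upTo⁺)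
open import Data.Product using (_×_; _,_; proj₁; ∃)
open import Data.Sum using (_⊎_; inj₁; inj₂)
open import Data.Empty using (⊥-elim)
open import Function using (_∘_; id)
open import Relation.Nullary using (yes; no)
open import Relation.Binary.PropositionalEquality using (refl; sym; trans; cong; cong₂; subst; _≢_; ≢-sym; module ≡-Reasoning)

open ≡-Reasoning

foldr-⊔-≤ : ∀ {v} xs → All (_≤ v) xs → foldr _⊔_ 0 xs ≤ v
foldr-⊔-≤ []       []         = z≤n
foldr-⊔-≤ (x ∷ xs) (x≤v ∷ ps) = ⊔-lub x≤v (foldr-⊔-≤ xs ps)

∈⇒≤-foldr-⊔ : ∀ {v} xs → v ∈ xs → v ≤ foldr _⊔_ 0 xs
∈⇒≤-foldr-⊔ (x ∷ xs) (here refl) = m≤m⊔n x _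
∈⇒≤-foldr-⊔ (x ∷ xs) (there v∈) = ≤-trans (∈⇒≤-foldr-⊔ xs v∈) (m≤n⊔m x _)

foldr-⊔-≡ : ∀ {v} xs → All (_≤ v) xs → v ∈ xs → foldr _⊔_ 0 xs ≡ v
foldr-⊔-≡ xs ≤v v∈ = ≤-antisym (foldr-⊔-≤ xs ≤v) (∈⇒≤-foldr-⊔ xs v∈)

concatMap-upTo-suc : ∀ {A : Set} (f : ℕ → List A) i → concatMap f (upTo (suc i)) ≡ concatMap f (upTo i) ++ f i
concatMap-upTo-suc f i = begin
  concatMap f (upTo (suc i))              ≡⟨ cong (concatMap f) (sym (upTo-∷ʳ i)) ⟩
  concatMap f (upTo i ∷ʳ i)               ≡⟨ concatMap-++ f (upTo i) [ i ] ⟩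
  concatMap f (upTo i) ++ (f i ++ [])     ≡⟨ cong (concatMap f (upTo i) ++_) (++-identityʳ (f i)) ⟩
  concatMap f (upTo i) ++ f i             ∎

arcCosts-++ : ∀ prev xs ys → arcCosts prev (xs ++ ys) ≡ arcCosts prev xs ++ arcCosts (prev ++ xs) ys
arcCosts-++ prev []       ys = cong (λ p → arcCosts p ys) (sym (++-identityʳ prev))
arcCosts-++ prev (x ∷ xs) ys = cong (arcCost prev x ∷_) (begin
  arcCosts (prev ++ [ x ]) (xs ++ ys)
    ≡⟨ arcCosts-++ (prev ++ [ x ]) xs ys ⟩
  arcCosts (prev ++ [ x ]) xs ++ arcCosts ((prev ++ [ x ]) ++ xs) ys
    ≡⟨ cong (λ p → arcCosts (prev ++ [ x ]) xs ++ arcCosts p ys) (++-assoc prev [ x ] xs) ⟩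
  arcCosts (prev ++ [ x ]) xs ++ arcCosts (prev ++ x ∷ xs) ys ∎)

arcCosts-map-upTo : ∀ prev (g : ℕ → Arc) q →
  arcCosts prev (map g (upTo q)) ≡ map (λ k → arcCost (prev ++ map g (upTo k)) (g k)) (upTo q)
arcCosts-map-upTo prev g zero    = refl
arcCosts-map-upTo prev g (suc q) = begin
  arcCosts prev (map g (upTo (suc q)))
    ≡⟨ cong (arcCosts prev ∘ map g) (sym (upTo-∷ʳ q)) ⟩
  arcCosts prev (map g (upTo q ∷ʳ q))
    ≡⟨ cong (arcCosts prev) (map-++ g (upTo q) [ q ]) ⟩
  arcCosts prev (map g (upTo q) ++ [ g q ])
    ≡⟨ arcCosts-++ prev (map g (upTo q)) [ g q ] ⟩
  arcCosts prev (map g (upTo q)) ++ [ c q ]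
    ≡⟨ cong (_++ [ c q ]) (arcCosts-map-upTo prev g q) ⟩
  map c (upTo q) ++ map c [ q ]
    ≡⟨ sym (map-++ c (upTo q) [ q ]) ⟩
  map c (upTo q ∷ʳ q)
    ≡⟨ cong (map c) (upTo-∷ʳ q) ⟩
  map c (upTo (suc q)) ∎
  where
  c : ℕ → ℕ
  c k = arcCost (prev ++ map g (upTo k)) (g k)

arcCosts-concatMap-upTo : ∀ (r : ℕ → List Arc) m →
  arcCosts [] (concatMap r (upTo m)) ≡ concatMap (λ i → arcCosts (concatMap r (upTo i)) (r i)) (upTo m)
arcCosts-concatMap-upTo r zero    = refl
arcCosts-concatMap-upTo r (suc m) = begin
  arcCosts [] (concatMap r (upTo (suc m)))
    ≡⟨ cong (arcCosts []) (concatMap-upTo-suc r m) ⟩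
  arcCosts [] (concatMap r (upTo m) ++ r m)
    ≡⟨ arcCosts-++ [] (concatMap r (upTo m)) (r m) ⟩
  arcCosts [] (concatMap r (upTo m)) ++ c m
    ≡⟨ cong (_++ c m) (arcCosts-concatMap-upTo r m) ⟩
  concatMap c (upTo m) ++ c m
    ≡⟨ sym (concatMap-upTo-suc c m) ⟩
  concatMap c (upTo (suc m)) ∎
  where
  c : ℕ → List ℕ
  c i = arcCosts (concatMap r (upTo i)) (r i)

rowCount-++ : ∀ i xs ys → rowCount i (xs ++ ys) ≡ rowCount i xs + rowCount i ys
rowCount-++ i xs ys =
  trans (cong length (filter-++ (λ f → proj₁ f ≟ i) xs ys)) (length-++ (filter (λ f → proj₁ f ≟ i) xs))

rowCount-map-self : ∀ i (f : ℕ → ℕ) xs → rowCount i (map (λ k → (i , f k)) xs) ≡ length xs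
rowCount-map-self i f []       = refl
rowCount-map-self i f (x ∷ xs) =
  trans (cong length (filter-accept (λ a → proj₁ a ≟ i) {xs = map (λ k → (i , f k)) xs} refl))
        (cong suc (rowCount-map-self i f xs))

rowCount-map-other : ∀ {i j} (f : ℕ → ℕ) xs → i ≢ j → rowCount j (map (λ k → (i , f k)) xs) ≡ 0
rowCount-map-other f []       i≢j = refl
rowCount-map-other {i} {j} f (x ∷ xs) i≢j =
  trans (cong length (filter-reject (λ a → proj₁ a ≟ j) {xs = map (λ k → (i , f k)) xs} i≢j))
        (rowCount-map-other f xs i≢j)

arcCost-after-own-queries : ∀ {i j} prev (f : ℕ → ℕ) k → rowCount i prev ≡ 0 → i ≢ j →
  arcCost (prev ++ map (λ x → (i , f x)) (upTo k)) (i , j) ≡ suc (k + rowCount j prev)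
arcCost-after-own-queries {i} {j} prev f k fresh i≢j = begin
  rowCount i (prev ++ own) + 1 + rowCount j (prev ++ own)
    ≡⟨ cong₂ (λ a b → a + 1 + b) (rowCount-++ i prev own) (rowCount-++ j prev own) ⟩
  (rowCount i prev + rowCount i own) + 1 + (rowCount j prev + rowCount j own)
    ≡⟨ cong₂ (λ a b → a + 1 + (rowCount j prev + b))
             (cong₂ _+_ fresh (trans (rowCount-map-self i f (upTo k)) (length-upTo k)))
             (rowCount-map-other f (upTo k) i≢j) ⟩
  k + 1 + (rowCount j prev + 0)
    ≡⟨ cong₂ _+_ (+-comm k 1) (+-identityʳ (rowCount j prev)) ⟩
  suc (k + rowCount j prev) ∎
  where
  own = map (λ x → (i , f x)) (upTo k)

firstRows : ℕ → ℕ → List Arc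
firstRows n i = concatMap (row n) (upTo i)

rowCount-row-other : ∀ n {i j} → i ≢ j → rowCount j (row n i) ≡ 0
rowCount-row-other zero    i≢j = refl
rowCount-row-other (suc m) {i} i≢j =
  rowCount-map-other (λ k → (i + suc k) % suc m) (upTo (numQueries (suc m) i)) i≢j

rowCount-row-self : ∀ m i → rowCount i (row (suc m) i) ≡ numQueries (suc m) i
rowCount-row-self m i =
  trans (rowCount-map-self i (λ k → (i + suc k) % suc m) (upTo (numQueries (suc m) i))) (length-upTo _)

rowCount-firstRows-≥ : ∀ n i {j} → i ≤ j → rowCount j (firstRows n i) ≡ 0
rowCount-firstRows-≥ n zero    i≤j = refl
rowCount-firstRows-≥ n (suc i) {j} i<j = begin
  rowCount j (firstRows n (suc i))                  ≡⟨ cong (rowCount j) (concatMap-upTo-suc (row n) i) ⟩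
  rowCount j (firstRows n i ++ row n i)             ≡⟨ rowCount-++ j (firstRows n i) (row n i) ⟩
  rowCount j (firstRows n i) + rowCount j (row n i) ≡⟨ cong₂ _+_ (rowCount-firstRows-≥ n i (<⇒≤ i<j))
                                                                 (rowCount-row-other n (<⇒≢ i<j)) ⟩
  0 ∎

rowCount-firstRows-< : ∀ m {i j} → j < i → rowCount j (firstRows (suc m) i) ≡ numQueries (suc m) j
rowCount-firstRows-< m {suc i} {j} j<1+i = begin
  rowCount j (firstRows (suc m) (suc i))
    ≡⟨ cong (rowCount j) (concatMap-upTo-suc (row (suc m)) i) ⟩
  rowCount j (firstRows (suc m) i ++ row (suc m) i)
    ≡⟨ rowCount-++ j (firstRows (suc m) i) (row (suc m) i) ⟩
  rowCount j (firstRows (suc m) i) + rowCount j (row (suc m) i)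
    ≡⟨ split (m≤n⇒m<n∨m≡n (s≤s⁻¹ j<1+i)) ⟩
  numQueries (suc m) j ∎
  where
  split : j < i ⊎ j ≡ i → rowCount j (firstRows (suc m) i) + rowCount j (row (suc m) i) ≡ numQueries (suc m) j
  split (inj₁ j<i) = trans (cong₂ _+_ (rowCount-firstRows-< m j<i) (rowCount-row-other (suc m) (≢-sym (<⇒≢ j<i))))
                           (+-identityʳ _)
  split (inj₂ refl) = cong₂ _+_ (rowCount-firstRows-≥ (suc m) j ≤-refl) (rowCount-row-self m j)

halves : ∀ n → (n % 2 ≡ 0 × n ≡ n / 2 + n / 2) ⊎ (n % 2 ≡ 1 × n ≡ suc (n / 2 + n / 2))
halves n = split (n % 2) refl (m%n<n n 2)
  where
  n≡%+h+h : n ≡ n % 2 + (n / 2 + n / 2)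
  n≡%+h+h = trans (m≡m%n+[m/n]*n n 2)
                  (cong (n % 2 +_) (trans (*-comm (n / 2) 2) (cong (n / 2 +_) (+-identityʳ (n / 2)))))
  split : ∀ r → n % 2 ≡ r → r < 2 →
          (n % 2 ≡ 0 × n ≡ n / 2 + n / 2) ⊎ (n % 2 ≡ 1 × n ≡ suc (n / 2 + n / 2))
  split 0 e _ = inj₁ (e , subst (λ r → n ≡ r + (n / 2 + n / 2)) e n≡%+h+h)
  split 1 e _ = inj₂ (e , subst (λ r → n ≡ r + (n / 2 + n / 2)) e n≡%+h+h)
  split (suc (suc _)) _ (s≤s (s≤s ()))

numQueries-odd : ∀ n {i} → n % 2 ≡ 1 → numQueries n i ≡ n / 2
numQueries-odd n n%2≡1 rewrite n%2≡1 = refl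

numQueries-even-< : ∀ n {i} → n % 2 ≡ 0 → i < n / 2 → numQueries n i ≡ n / 2
numQueries-even-< n {i} n%2≡0 i<h rewrite n%2≡0 with n / 2 ≤ᵇ i in le
... | false = refl
... | true  = ⊥-elim (<⇒≱ i<h (≤ᵇ⇒≤ (n / 2) i (subst T (sym le) _)))

numQueries-even-≥ : ∀ n {i} → n % 2 ≡ 0 → n / 2 ≤ i → numQueries n i ≡ n / 2 ∸ 1
numQueries-even-≥ n {i} n%2≡0 h≤i rewrite n%2≡0 with n / 2 ≤ᵇ i | ≤⇒≤ᵇ h≤i
... | true | _ = refl

numQueries≤half : ∀ n i → numQueries n i ≤ n / 2
numQueries≤half n i with (n % 2 ≡ᵇ 0) ∧ (n / 2 ≤ᵇ i)
... | true  = m∸n≤m _ 1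
... | false = ≤-refl

half+half≤ : ∀ n → n / 2 + n / 2 ≤ n
half+half≤ n with halves n
... | inj₁ (_ , n≡h+h)   = ≤-reflexive (sym n≡h+h)
... | inj₂ (_ , n≡1+h+h) = ≤-trans (n≤1+n _) (≤-reflexive (sym n≡1+h+h))

half≤pred : ∀ m → suc m / 2 ≤ m
half≤pred m = s≤s⁻¹ (m/n<m (suc m) 2 (s≤s (s≤s z≤n)))

numQueries-wrapped-sum : ∀ n {i} j → n / 2 ≤ i → numQueries n i + numQueries n j ≤ n ∸ 1
numQueries-wrapped-sum n {i} j h≤i with halves n
... | inj₂ (n%2≡1 , n≡1+h+h) = ≤-reflexive (begin
  numQueries n i + numQueries n j ≡⟨ cong₂ _+_ (numQueries-odd n n%2≡1) (numQueries-odd n n%2≡1) ⟩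
  n / 2 + n / 2                   ≡⟨ cong (_∸ 1) (sym n≡1+h+h) ⟩
  n ∸ 1                           ∎)
... | inj₁ (n%2≡0 , n≡h+h) =
  ≤-trans (+-mono-≤ (≤-reflexive (numQueries-even-≥ n n%2≡0 h≤i)) (numQueries≤half n j))
          (≤-trans (pred-+-≤ (n / 2)) (≤-reflexive (cong (_∸ 1) (sym n≡h+h))))
  where
  pred-+-≤ : ∀ h → h ∸ 1 + h ≤ h + h ∸ 1
  pred-+-≤ zero    = z≤n
  pred-+-≤ (suc h) = ≤-refl

numQueries-last : ∀ m → 2 ≤ m →
  ∃ λ k → numQueries (suc m) m ≡ suc k × suc k + numQueries (suc m) k ≡ m
numQueries-last m 2≤m with halves (suc m)
... | inj₂ (n%2≡1 , n≡1+h+h) =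
  odd (suc m / 2) (suc-injective n≡1+h+h) (λ i → numQueries-odd (suc m) {i} n%2≡1)
  where
  odd : ∀ h → m ≡ h + h → (∀ i → numQueries (suc m) i ≡ h) →
        ∃ λ k → numQueries (suc m) m ≡ suc k × suc k + numQueries (suc m) k ≡ m
  odd zero    m≡0 _  = ⊥-elim (<⇒≱ (subst (2 ≤_) m≡0 2≤m) z≤n)
  odd (suc k) m≡h+h q≡h = k , q≡h m , trans (cong (suc k +_) (q≡h k)) (sym m≡h+h)
... | inj₁ (n%2≡0 , n≡h+h) =
  even (suc m / 2) n≡h+h (numQueries-even-≥ (suc m) n%2≡0 (half≤pred m))
       (λ i → numQueries-even-< (suc m) {i} n%2≡0)
  where
  even : ∀ h → suc m ≡ h + h → numQueries (suc m) m ≡ h ∸ 1 → (∀ i → i < h → numQueries (suc m) i ≡ h) →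
         ∃ λ k → numQueries (suc m) m ≡ suc k × suc k + numQueries (suc m) k ≡ m
  even (suc zero)    1+m≡2   _    _   = ⊥-elim (<-irrefl (sym (suc-injective 1+m≡2)) 2≤m)
  even (suc (suc k)) 1+m≡h+h q≡h∸1 q≡h =
    k , q≡h∸1 , trans (cong (suc k +_) (q≡h k (m<n⇒m<1+n (n<1+n k)))) (sym (suc-injective 1+m≡h+h))

query-index-bound : ∀ m {i k} → k < numQueries (suc m) i → suc k ≤ m
query-index-bound m {i} k<q = ≤-trans k<q (≤-trans (numQueries≤half (suc m) i) (half≤pred m))

%-wrap : ∀ {n t} .{{_ : NonZero n}} → n ≤ t → t < n + n → t % n ≡ t ∸ n
%-wrap {n} {t} n≤t t<n+n = begin
  t % n           ≡⟨ cong (_% n) (sym (m∸n+n≡m n≤t)) ⟩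
  (t ∸ n + n) % n ≡⟨ [m+n]%n≡m%n (t ∸ n) n ⟩
  (t ∸ n) % n     ≡⟨ m<n⇒m%n≡m (m<n+o⇒m∸n<o t n t<n+n) ⟩
  t ∸ n           ∎

queryCost : ℕ → ℕ → ℕ → ℕ
queryCost zero      i k = 0
queryCost n@(suc _) i k = suc (k + rowCount ((i + suc k) % n) (firstRows n i))

queryCost-forward : ∀ m i k → i + suc k < suc m → queryCost (suc m) i k ≡ suc k
queryCost-forward m i k t<n = begin
  suc (k + rowCount ((i + suc k) % suc m) (firstRows (suc m) i))
    ≡⟨ cong (λ t → suc (k + rowCount t (firstRows (suc m) i))) (m<n⇒m%n≡m t<n) ⟩
  suc (k + rowCount (i + suc k) (firstRows (suc m) i))
    ≡⟨ cong (λ c → suc (k + c)) (rowCount-firstRows-≥ (suc m) i (m≤m+n i (suc k))) ⟩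
  suc (k + 0)
    ≡⟨ cong suc (+-identityʳ k) ⟩
  suc k ∎

wrapped-target< : ∀ {n i k} → suc k < n → n ≤ i + suc k → i + suc k ∸ n < i
wrapped-target< {n} {i} {k} k<n n≤t =
  subst (i + suc k ∸ n <_) (m+n∸n≡m i n) (∸-monoˡ-< (+-monoʳ-< i k<n) n≤t)

wrapped-target : ∀ m {i k} → i < suc m → suc k < suc m → suc m ≤ i + suc k →
  (i + suc k) % suc m ≡ i + suc k ∸ suc m
wrapped-target m i<n k<n n≤t = %-wrap n≤t (+-mono-< i<n k<n)

queryCost-wrapped : ∀ m {i k} → i < suc m → suc k < suc m → suc m ≤ i + suc k →
  queryCost (suc m) i k ≡ suc k + numQueries (suc m) (i + suc k ∸ suc m)
queryCost-wrapped m {i} {k} i<n k<n n≤t = begin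
  suc (k + rowCount ((i + suc k) % suc m) (firstRows (suc m) i))
    ≡⟨ cong (λ t → suc (k + rowCount t (firstRows (suc m) i))) (wrapped-target m i<n k<n n≤t) ⟩
  suc (k + rowCount (i + suc k ∸ suc m) (firstRows (suc m) i))
    ≡⟨ cong (λ c → suc (k + c)) (rowCount-firstRows-< m (wrapped-target< k<n n≤t)) ⟩
  suc k + numQueries (suc m) (i + suc k ∸ suc m) ∎

target≢self : ∀ m {i k} → i < suc m → suc k < suc m → (i + suc k) % suc m ≢ i
target≢self m {i} {k} i<n k<n with i + suc k <? suc m
... | yes t<n = λ t≡i → <-irrefl (sym (trans (sym (m<n⇒m%n≡m t<n)) t≡i)) (m<m+n i z<s)
... | no  t≮n = λ t≡i → <-irrefl (trans (sym (wrapped-target m i<n k<n (≮⇒≥ t≮n))) t≡i)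
                                 (wrapped-target< k<n (≮⇒≥ t≮n))

queryCost≤ : ∀ m {i k} → i < suc m → k < numQueries (suc m) i → queryCost (suc m) i k ≤ m
queryCost≤ m {i} {k} i<n k<q with i + suc k <? suc m
... | yes t<n = subst (_≤ m) (sym (queryCost-forward m i k t<n)) (query-index-bound m k<q)
... | no  t≮n = subst (_≤ m) (sym (queryCost-wrapped m i<n (s≤s (query-index-bound m k<q)) n≤t))
                  (≤-trans (+-monoˡ-≤ _ k<q) (numQueries-wrapped-sum (suc m) (i + suc k ∸ suc m) h≤i))
  where
  n≤t : suc m ≤ i + suc k
  n≤t = ≮⇒≥ t≮n
  h≤i : suc m / 2 ≤ i
  h≤i = +-cancelʳ-≤ (suc m / 2) (suc m / 2) i
          (≤-trans (half+half≤ (suc m))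
            (≤-trans n≤t (+-monoʳ-≤ i (≤-trans k<q (numQueries≤half (suc m) i)))))

queryCost-last : ∀ m → 2 ≤ m → ∃ λ k → k < numQueries (suc m) m × queryCost (suc m) m k ≡ m
queryCost-last m 2≤m with numQueries-last m 2≤m
... | k , q≡1+k , 1+k+q≡m = k , k<q , (begin
  queryCost (suc m) m k                          ≡⟨ queryCost-wrapped m ≤-refl (s≤s (query-index-bound m k<q)) n≤t ⟩
  suc k + numQueries (suc m) (m + suc k ∸ suc m) ≡⟨ cong (λ j → suc k + numQueries (suc m) j)
                                                         (trans (cong (_∸ suc m) (+-suc m k)) (m+n∸m≡n m k)) ⟩
  suc k + numQueries (suc m) k                   ≡⟨ 1+k+q≡m ⟩
  m                                              ∎)
  where
  k<q : k < numQueries (suc m) m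
  k<q = subst (k <_) (sym q≡1+k) ≤-refl
  n≤t : suc m ≤ m + suc k
  n≤t = subst (suc m ≤_) (sym (+-suc m k)) (s≤s (m≤m+n m k))

queryCosts : ℕ → List ℕ
queryCosts n = concatMap (λ i → map (queryCost n i) (upTo (numQueries n i))) (upTo n)

arcCosts-row : ∀ m {i} → i < suc m →
  arcCosts (firstRows (suc m) i) (row (suc m) i) ≡ map (queryCost (suc m) i) (upTo (numQueries (suc m) i))
arcCosts-row m {i} i<n =
  trans (arcCosts-map-upTo (firstRows (suc m) i) (λ k → (i , (i + suc k) % suc m)) (numQueries (suc m) i))
        (map-cong-local (applyUpTo⁺₁ id (numQueries (suc m) i) λ {k} k<q →
          arcCost-after-own-queries (firstRows (suc m) i) (λ x → (i + suc x) % suc m) k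
            (rowCount-firstRows-≥ (suc m) i ≤-refl)
            (≢-sym (target≢self m i<n (s≤s (query-index-bound m k<q))))))

arcCosts-halfInTurn : ∀ m → arcCosts [] (halfInTurn (suc m)) ≡ queryCosts (suc m)
arcCosts-halfInTurn m =
  trans (arcCosts-concatMap-upTo (row (suc m)) (suc m))
        (cong concat (map-cong-local (applyUpTo⁺₁ id (suc m) (arcCosts-row m))))

queryCosts≤ : ∀ m → All (_≤ m) (queryCosts (suc m))
queryCosts≤ m = concat⁺ (map⁺ (applyUpTo⁺₁ id (suc m) λ i<n →
                  map⁺ (applyUpTo⁺₁ id _ (queryCost≤ m i<n))))

∈-queryCosts : ∀ m → 2 ≤ m → m ∈ queryCosts (suc m)
∈-queryCosts m 2≤m with queryCost-last m 2≤m
... | k , k<q , cost≡m =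
  ∈-concatMap⁺ (λ i → map (queryCost (suc m) i) (upTo (numQueries (suc m) i)))
    (lose (∈-upTo⁺ (n<1+n m)) (subst (_∈ map (queryCost (suc m) m) (upTo (numQueries (suc m) m))) cost≡m
                                      (∈-map⁺ (queryCost (suc m) m) (∈-upTo⁺ k<q))))

lemma2 : (n : ℕ) → 2 ≤ n → cost (halfInTurn n) ≡ n ∸ 1
lemma2 (suc zero)            (s≤s ())
lemma2 (suc (suc zero))      _ = refl
lemma2 (suc m@(suc (suc _))) _ = begin
  foldr _⊔_ 0 (arcCosts [] (halfInTurn (suc m))) ≡⟨ cong (foldr _⊔_ 0) (arcCosts-halfInTurn m) ⟩
  foldr _⊔_ 0 (queryCosts (suc m))               ≡⟨ foldr-⊔-≡ _ (queryCosts≤ m) (∈-queryCosts m (s≤s (s≤s z≤n))) ⟩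
  m                                              ∎
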